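{- Let $n\ge1$ and $w\in U_n$. Then there is no homing shuffle $F:S_n\to S_n$ that sorts $w$.
   Context: $[n]=\{1,\dots,n\}$, $S_n$ is the group of bijections $[n]\to[n]$ with product $(ab)(i)=a(b(i))$ and identity $\varepsilon$. A homing shuffle is a map $F:S_n\to S_n$ such that for every $w\in S_n$, setting $k:=w(1)$: (a) $F(w)(k)=k$, and (b) $F(w)(i)=w(i)$ for all $i>k$. $F$ sorts $w$ if $F^m(w)=\varepsilon$ for some $m\in\mathbb{N}$ ($F^m$ the $m$-th iterate). For $w\in S_n$, $i_w$ is the smallest $k\in[n]$ with $w([k])=[k]$. $U_n:=\{w\in S_n : \text{there is } i>i_w \text{ with } w(i)\neq i\}$. -}

module Defs where

open import Data.Nat as ℕ using (ℕ; zero; suc; _≤_)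
open import Data.Fin as Fin using (Fin; toℕ)
open import Data.Fin.Permutation using (Permutation′; _⟨$⟩ʳ_; id; _≈_)
open import Data.Product using (Σ; ∃; _×_; _,_)
open import Relation.Binary.PropositionalEquality using (_≡_; _≢_)
open import Relation.Nullary using (¬_)

-- Convention: [n] = {1,…,n} is represented by Fin n, where the element
-- j : Fin n stands for the number toℕ j + 1.  S_n = Permutation′ n.
-- Equality of permutations is pointwise equality (_≈_).

first : ∀ {m} → Permutation′ (suc m) → Fin (suc m)
first w = w ⟨$⟩ʳ Fin.zero

-- j ∈ [k]  (1-based)  ⇔  toℕ j < k  (0-based Fin)
InPrefix : ∀ {n} → ℕ → Fin n → Set
InPrefix k j = toℕ j ℕ.< k

FixesPrefix : ∀ {n} → Permutation′ n → ℕ → Set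
FixesPrefix {n} w k =
  (∀ (j : Fin n) → InPrefix k j → InPrefix k (w ⟨$⟩ʳ j)) ×
  (∀ (j : Fin n) → InPrefix k j → Σ (Fin n) λ i → InPrefix k i × (w ⟨$⟩ʳ i ≡ j))

IsIw : ∀ {n} → Permutation′ n → ℕ → Set
IsIw {n} w k =
  (1 ≤ k) × (k ≤ n) × FixesPrefix w k ×
  (∀ k′ → 1 ≤ k′ → k′ ℕ.< k → ¬ FixesPrefix w k′)

-- w ∈ U_n : there is i > i_w with w(i) ≠ i.
-- (1-based i > k  ⇔  0-based toℕ i ≥ k.)
InU : ∀ {n} → Permutation′ n → Set
InU {n} w = Σ ℕ λ k → IsIw w k ×
  Σ (Fin n) λ i → (k ≤ toℕ i) × (w ⟨$⟩ʳ i ≢ i)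

-- Homing shuffle (n ≥ 1 so that w(1) exists).
IsHomingShuffle : ∀ {m} → (Permutation′ (suc m) → Permutation′ (suc m)) → Set
IsHomingShuffle {m} F = ∀ (w : Permutation′ (suc m)) →
  (F w ⟨$⟩ʳ first w ≡ first w) ×
  (∀ (i : Fin (suc m)) → first w Fin.< i → F w ⟨$⟩ʳ i ≡ w ⟨$⟩ʳ i)

iter : ∀ {A : Set} → (A → A) → ℕ → A → A
iter f zero x = x
iter f (suc m) x = f (iter f m x)

Sorts : ∀ {m} → (Permutation′ (suc m) → Permutation′ (suc m)) → Permutation′ (suc m) → Set
Sorts F w = ∃ λ m → iter F m w ≈ id

-- Let k = i_w.  Since w maps [k] into [k], any permutation v agreeing with w
-- beyond k also maps [k] into [k]: if p ≤ k and v(p) > k, the w-preimage j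
-- of v(p) lies beyond k, so v(j) = w(j) = v(p) and p = j, which is absurd.
-- In particular v(1) ≤ k, so a homing shuffle leaves all positions beyond k
-- untouched, and every iterate F^t(w) agrees with w beyond k.
-- As w moves some i > k, no iterate is ε.
module Submission where

open import Defs
open import Data.Nat using (ℕ; suc; _≤_; _<_)
open import Data.Nat.Properties using (<-≤-trans; ≮⇒≥; <⇒≱; _<?_)
open import Data.Fin as Fin using (Fin; toℕ)
open import Data.Fin.Permutation using (Permutation′; _⟨$⟩ʳ_; _⟨$⟩ˡ_; inverseˡ; inverseʳ)
open import Data.Product using (_,_; proj₂)
open import Relation.Binary.PropositionalEquality using (_≡_; refl; sym; trans; cong; subst; module ≡-Reasoning)
open import Relation.Nullary using (¬_; yes; no; contradiction)

iter-preserves : ∀ {A : Set} (P : A → Set) (f : A → A) →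
  (∀ x → P x → P (f x)) → ∀ t {x} → P x → P (iter f t x)
iter-preserves P f step ℕ.zero  px = px
iter-preserves P f step (suc t) px = step _ (iter-preserves P f step t px)

⟨$⟩ʳ-injective : ∀ {n} (v : Permutation′ n) {i j} → v ⟨$⟩ʳ i ≡ v ⟨$⟩ʳ j → i ≡ j
⟨$⟩ʳ-injective v {i} {j} vi≡vj = begin
  i                    ≡⟨ sym (inverseˡ v) ⟩
  v ⟨$⟩ˡ (v ⟨$⟩ʳ i)    ≡⟨ cong (v ⟨$⟩ˡ_) vi≡vj ⟩
  v ⟨$⟩ˡ (v ⟨$⟩ʳ j)    ≡⟨ inverseˡ v ⟩
  j                    ∎
  where open ≡-Reasoning

MapsPrefixInto : ∀ {n} → Permutation′ n → ℕ → Set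
MapsPrefixInto {n} w k = ∀ (j : Fin n) → InPrefix k j → InPrefix k (w ⟨$⟩ʳ j)

AgreesBeyond : ∀ {n} → ℕ → Permutation′ n → Permutation′ n → Set
AgreesBeyond {n} k w v = ∀ (j : Fin n) → k ≤ toℕ j → v ⟨$⟩ʳ j ≡ w ⟨$⟩ʳ j

module _ {n} {k : ℕ} {w : Permutation′ n} (w-into : MapsPrefixInto w k) where

  preimage-beyond : ∀ {x : Fin n} → k ≤ toℕ x → k ≤ toℕ (w ⟨$⟩ˡ x)
  preimage-beyond {x} k≤x with toℕ (w ⟨$⟩ˡ x) <? k
  ... | no  j≮k = ≮⇒≥ j≮k
  ... | yes j<k = contradiction k≤x (<⇒≱ (subst (λ y → toℕ y < k) (inverseʳ w) (w-into _ j<k)))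

  agreeing-maps-prefix-into : ∀ {v} → AgreesBeyond k w v → MapsPrefixInto v k
  agreeing-maps-prefix-into {v} agree p p<k with toℕ (v ⟨$⟩ʳ p) <? k
  ... | yes vp<k = vp<k
  ... | no  vp≮k = contradiction (subst (λ y → k ≤ toℕ y) (sym p≡j) k≤j) (<⇒≱ p<k)
    where
    j : Fin n
    j = w ⟨$⟩ˡ (v ⟨$⟩ʳ p)
    k≤j : k ≤ toℕ j
    k≤j = preimage-beyond (≮⇒≥ vp≮k)
    p≡j : p ≡ j
    p≡j = ⟨$⟩ʳ-injective v (sym (trans (agree j k≤j) (inverseʳ w)))

module _ {m} {k : ℕ} {w : Permutation′ (suc m)} (0<k : 0 < k) (w-into : MapsPrefixInto w k)
         {F : Permutation′ (suc m) → Permutation′ (suc m)} (homing : IsHomingShuffle F) where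

  homing-preserves-agreement : ∀ v → AgreesBeyond k w v → AgreesBeyond k w (F v)
  homing-preserves-agreement v agree j k≤j =
    trans (proj₂ (homing v) j (<-≤-trans first<k k≤j)) (agree j k≤j)
    where
    first<k : toℕ (first v) < k
    first<k = agreeing-maps-prefix-into {k = k} {w} w-into {v} agree Fin.zero 0<k

  iterates-agree : ∀ t → AgreesBeyond k w (iter F t w)
  iterates-agree t = iter-preserves (AgreesBeyond k w) F homing-preserves-agreement t (λ _ _ → refl)

theorem3 : ∀ (m : ℕ) (w : Permutation′ (suc m)) → InU w →
    (F : Permutation′ (suc m) → Permutation′ (suc m)) →
    IsHomingShuffle F → ¬ Sorts F w
theorem3 m w (k , (1≤k , _ , (w-into , _) , _) , i , k≤i , wi≢i) F homing (t , sorted) =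
  wi≢i (trans (sym (iterates-agree 1≤k w-into homing t i k≤i)) (sorted i))
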